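{- For any integers $N\geq 1$ and $1\leq k<l$, there exists an algorithm using only the moves $\phi_k$ and $\phi_l$ which couples the first $N$ balls. Moreover, the length of this algorithm can be taken to be less than $N+4l^2$.
   Context: An infinite configuration is a sequence $X=(X(i))_{i\in\mathbb{Z}_{\le 0}}$ of positive integers indexed by the nonpositive integers; $X(i)$ is the number of balls in bin $i$ (bin $0$ is the rightmost bin). For an integer $k\geq1$, the move of type $k$ is the map $\phi_k$ from infinite configurations to infinite configurations defined as follows. If $X(0)\geq k$, then $Y=\phi_k(X)$ is given by $Y(0)=1$ and $Y(i)=X(i+1)$ for $i<0$ (a new rightmost bin with one ball is created and bins are relabeled). If $X(0)<k$, let $i_k=\min\{j\in\mathbb{Z}_{\le0} : \sum_{i=j}^{0}X(i)<k\}$ and set $Y(i_k)=X(i_k)+1$ and $Y(i)=X(i)$ for $i\neq i_k$. (In words: one ball is added to the bin immediately to the right of the bin containing the $k$-th ball, balls counted from right to left.) For a positive integer $n$ and an infinite configuration $X$, the $n$-ball projection $\pi_n(X)$ is the sequence indexed by $\mathbb{Z}_{\le0}$ with $(\pi_n(X))_i=\min\big(X(i),\,n-\sum_{j=i+1}^{0}X(j)\big)$ if $\sum_{j=i+1}^0X(j)<n$ and $(\pi_n(X))_i=0$ otherwise (i.e. one keeps only the rightmost $n$ balls). An algorithm is a finite composition of moves $\phi_{k_1}\circ\cdots\circ\phi_{k_m}$; its length is the number $m$ of moves composed. An algorithm $\Phi$ couples the first $n$ balls if $\pi_n(\Phi(X))=\pi_n(\Phi(Y))$ for any two infinite configurations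 $X,Y$. -}

module Defs where

open import Data.Nat using (ℕ; zero; suc; _+_; _∸_; _⊓_; _≤_; _<_; _≤ᵇ_; _<ᵇ_)
open import Data.Bool using (if_then_else_; _∧_)
open import Data.List using (List; []; _∷_)
open import Relation.Binary.PropositionalEquality using (_≡_)

-- An infinite configuration: X m is the number of balls in bin (-m),
-- i.e. index 0 is the rightmost bin, index m corresponds to bin -m.
Config : Set
Config = ℕ → ℕ

Positive : Config → Set
Positive X = ∀ m → 1 ≤ X m

P : Config → ℕ → ℕ
P X zero    = 0
P X (suc m) = P X m + X m

-- If X(0) ≥ k, a new rightmost bin with one ball is created.
-- Otherwise one ball is added to bin i_k, which (for positive configurations,
-- whose partial sums are strictly increasing) is the unique index m with
-- (sum of bins 0..-m) < k ≤ (sum of bins 0..-(m+1)), i.e. the leftmost bin j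
-- with sum_{i=j}^0 X(i) < k.
φ : ℕ → Config → Config
φ k X m =
  if k ≤ᵇ X 0
  then (case m)
  else (if (P X (suc m) <ᵇ k) ∧ (k ≤ᵇ P X (suc (suc m))) then suc (X m) else X m)
  where
    case : ℕ → ℕ
    case zero    = 1
    case (suc j) = X j

-- n-ball projection: keep only the rightmost n balls.
-- (π n X) m = min (X m, n - P X m) if P X m < n, and 0 otherwise;
-- with truncated subtraction both cases are the single formula below.
π : ℕ → Config → Config
π n X m = if P X m <ᵇ n then X m ⊓ (n ∸ P X m) else 0

-- An algorithm φ_{k1} ∘ ... ∘ φ_{km} is the list k1 ∷ ... ∷ km ∷ [];
-- the last move in the list is applied first.
run : List ℕ → Config → Config
run []       X = X
run (k ∷ ks) X = φ k (run ks X)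

Couples : ℕ → List ℕ → Set
Couples n ks = ∀ (X Y : Config) → Positive X → Positive Y →
  ∀ m → π n (run ks X) m ≡ π n (run ks Y) m

-- Write k = K + 1, l = L + 2, and call X primed when its l-th ball lies in bin 0 or bin -1.
-- On an unprimed configuration φ_l adds a ball to a bin whose prefix sum is still below l, so the
-- total shortfall of the l rightmost prefix sums, at most l², drops with every move: l² moves φ_l
-- prime any configuration.  A primed configuration has a phase j = min (X 0, l) ∈ {1, …, l}; φ_l
-- rotates it, j ↦ j + 1 (mod l), and φ_k acts like φ_l except for one extra step on k ≤ j < l
-- (once the φ_l moves needed to return to a phase are done).  Hence K blocks φ_l^L ∘ φ_k, which
-- lower phases below k and keep phases ≥ k at least k, push every phase to at least k, and then
-- l - k blocks φ_l^(L+1) ∘ φ_k, which raise phases in [k, l), bring every configuration to phase l,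
-- that is X 0 ≥ l.  From there N moves φ_l fill the bins deterministically as (b, l, …, l, ≥ l)
-- with N balls in the listed bins, which couples the first N balls.
-- The length is N + l² + K (l - 1) + (l - k) l < N + 4 l².
module Submission where

open import Defs
open import Data.Bool using (true; false; _∧_)
open import Data.Empty using (⊥-elim)
open import Data.List using (List; []; _∷_; _++_; [_]; concat; replicate; length)
open import Data.List.Properties using (length-++; length-replicate)
open import Data.List.Relation.Unary.All using (All; []; _∷_)
open import Data.List.Relation.Unary.All.Properties using (++⁺; concat⁺; replicate⁺)
open import Data.Nat using (ℕ; zero; suc; _+_; _*_; _^_; _∸_; _≤_; _<_; _≤ᵇ_; _<ᵇ_; z≤n; s≤s; _≤?_; _<?_)
open import Data.Nat.GeneralisedArithmetic using (iterate)
open import Data.Nat.Properties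
open import Data.Product using (Σ; Σ-syntax; _×_; _,_; proj₁; proj₂)
open import Function using (_∘_)
open import Data.Sum using (_⊎_; inj₁; inj₂)
open import Relation.Nullary using (¬_; yes; no)
open import Relation.Nullary.Reflects using (ofʸ; ofⁿ; det)
open import Relation.Binary.PropositionalEquality using (_≡_; refl; sym; trans; cong; cong₂; subst; subst₂; module ≡-Reasoning)

≤ᵇ-true : ∀ {m n} → m ≤ n → (m ≤ᵇ n) ≡ true
≤ᵇ-true m≤n = det (≤ᵇ-reflects-≤ _ _) (ofʸ m≤n)

≤ᵇ-false : ∀ {m n} → n < m → (m ≤ᵇ n) ≡ false
≤ᵇ-false n<m = det (≤ᵇ-reflects-≤ _ _) (ofⁿ (<⇒≱ n<m))

<ᵇ-true : ∀ {m n} → m < n → (m <ᵇ n) ≡ true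
<ᵇ-true m<n = det (<ᵇ-reflects-< _ _) (ofʸ m<n)

<ᵇ-false : ∀ {m n} → n ≤ m → (m <ᵇ n) ≡ false
<ᵇ-false n≤m = det (<ᵇ-reflects-< _ _) (ofⁿ (≤⇒≯ n≤m))

iterate-+ : ∀ {A : Set} (f : A → A) x m n → iterate f x (m + n) ≡ iterate f (iterate f x m) n
iterate-+ f x zero    n = refl
iterate-+ f x (suc m) n = iterate-+ f (f x) m n

iterate-suc : ∀ {A : Set} (f : A → A) x n → iterate f x (suc n) ≡ f (iterate f x n)
iterate-suc f x zero    = refl
iterate-suc f x (suc n) = iterate-suc f (f x) n

crossing : ∀ (f : ℕ → ℕ) {c} d i → f i < c → c ≤ f (d + i) → Σ[ m ∈ ℕ ] f m < c × c ≤ f (suc m)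
crossing f zero    i fi<c c≤fi = ⊥-elim (<⇒≱ fi<c c≤fi)
crossing f {c} (suc d) i fi<c c≤f with c ≤? f (suc i)
... | yes c≤fsi = i , fi<c , c≤fsi
... | no  c≰fsi = crossing f d (suc i) (≰⇒> c≰fsi) (subst (λ n → c ≤ f n) (sym (+-suc d i)) c≤f)

P-monoʳ-≤ : ∀ X {i j} → i ≤ j → P X i ≤ P X j
P-monoʳ-≤ X {j = zero}      z≤n   = ≤-refl
P-monoʳ-≤ X {i} {suc j} i≤1+j with m≤n⇒m<n∨m≡n i≤1+j
... | inj₁ (s≤s i≤j) = ≤-trans (P-monoʳ-≤ X i≤j) (m≤m+n _ _)
... | inj₂ refl      = ≤-refl

P-monoˡ-≤ : ∀ {X Y} → (∀ m → X m ≤ Y m) → ∀ n → P X n ≤ P Y n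
P-monoˡ-≤ X≤Y zero    = ≤-refl
P-monoˡ-≤ X≤Y (suc n) = +-mono-≤ (P-monoˡ-≤ X≤Y n) (X≤Y n)

P-≥-index : ∀ {X} → Positive X → ∀ n → n ≤ P X n
P-≥-index pos zero    = z≤n
P-≥-index {X} pos (suc n) = subst (_≤ P X (suc n)) (+-comm n 1) (+-mono-≤ (P-≥-index pos n) (pos n))

P-cong-prefix : ∀ {X Y a} → (∀ i → i ≤ a → X i ≡ Y i) → ∀ i → i ≤ suc a → P X i ≡ P Y i
P-cong-prefix agree zero    _       = refl
P-cong-prefix agree (suc i) (s≤s i≤a) =
  cong₂ _+_ (P-cong-prefix agree i (m≤n⇒m≤1+n i≤a)) (agree i i≤a)

π-beyond : ∀ {N X m} → N ≤ P X m → π N X m ≡ 0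
π-beyond N≤P rewrite <ᵇ-false N≤P = refl

π-cong-prefix : ∀ {N a X Y} → (∀ i → i ≤ a → X i ≡ Y i) → N ≤ P X (suc a) →
                ∀ m → π N X m ≡ π N Y m
π-cong-prefix {N} {a} {X} {Y} agree N≤PX m with m ≤? a
... | yes m≤a rewrite P-cong-prefix agree m (m≤n⇒m≤1+n m≤a) | agree m m≤a = refl
... | no  m≰a =
  let N≤PY = subst (N ≤_) (P-cong-prefix agree (suc a) ≤-refl) N≤PX
  in  trans (π-beyond {N} {X} (≤-trans N≤PX (P-monoʳ-≤ X (≰⇒> m≰a))))
            (sym (π-beyond {N} {Y} (≤-trans N≤PY (P-monoʳ-≤ Y (≰⇒> m≰a)))))

φ-opens-head : ∀ {k} X → k ≤ X 0 → φ k X 0 ≡ 1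
φ-opens-head X k≤X0 rewrite ≤ᵇ-true k≤X0 = refl

φ-shifts : ∀ {k} X m → k ≤ X 0 → φ k X (suc m) ≡ X m
φ-shifts X m k≤X0 rewrite ≤ᵇ-true k≤X0 = refl

φ-hits : ∀ {k} X m → X 0 < k → P X (suc m) < k → k ≤ P X (suc (suc m)) → φ k X m ≡ suc (X m)
φ-hits X m X0<k below above rewrite ≤ᵇ-false X0<k | <ᵇ-true below | ≤ᵇ-true above = refl

φ-fixes-left : ∀ {k} X m → X 0 < k → k ≤ P X (suc m) → φ k X m ≡ X m
φ-fixes-left X m X0<k above rewrite ≤ᵇ-false X0<k | <ᵇ-false above = refl

φ-fixes-right : ∀ {k} X m → X 0 < k → P X (suc (suc m)) < k → φ k X m ≡ X m
φ-fixes-right {k} X m X0<k below rewrite ≤ᵇ-false X0<k | ≤ᵇ-false below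
  with P X (suc m) <ᵇ k
... | true  = refl
... | false = refl

φ-inflationary : ∀ {k} X m → X 0 < k → X m ≤ φ k X m
φ-inflationary {k} X m X0<k rewrite ≤ᵇ-false X0<k
  with (P X (suc m) <ᵇ k) ∧ (k ≤ᵇ P X (suc (suc m)))
... | true  = n≤1+n _
... | false = ≤-refl

φ-positive : ∀ {k X} → Positive X → Positive (φ k X)
φ-positive {k} {X} pos m with k ≤? X 0
φ-positive {X = X} pos zero    | yes k≤X0 = ≤-reflexive (sym (φ-opens-head X k≤X0))
φ-positive {X = X} pos (suc m) | yes k≤X0 = subst (1 ≤_) (sym (φ-shifts X m k≤X0)) (pos m)
φ-positive {X = X} pos m       | no  k≰X0 = ≤-trans (pos m) (φ-inflationary X m (≰⇒> k≰X0))

run-++ : ∀ ks ks′ X → run (ks ++ ks′) X ≡ run ks (run ks′ X)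
run-++ []       ks′ X = refl
run-++ (k ∷ ks) ks′ X = cong (φ k) (run-++ ks ks′ X)

run-replicate : ∀ n k X → run (replicate n k) X ≡ iterate (φ k) X n
run-replicate zero    k X = refl
run-replicate (suc n) k X = trans (cong (φ k) (run-replicate n k X)) (sym (iterate-suc (φ k) X n))

run-concat-replicate : ∀ n ks X → run (concat (replicate n ks)) X ≡ iterate (run ks) X n
run-concat-replicate zero    ks X = refl
run-concat-replicate (suc n) ks X = begin
  run (ks ++ concat (replicate n ks)) X   ≡⟨ run-++ ks _ X ⟩
  run ks (run (concat (replicate n ks)) X) ≡⟨ cong (run ks) (run-concat-replicate n ks X) ⟩
  run ks (iterate (run ks) X n)            ≡⟨ sym (iterate-suc (run ks) X n) ⟩
  iterate (run ks) X (suc n)               ∎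
  where open ≡-Reasoning

length-concat-replicate : ∀ n (ks : List ℕ) → length (concat (replicate n ks)) ≡ n * length ks
length-concat-replicate zero    ks = refl
length-concat-replicate (suc n) ks =
  trans (length-++ ks) (cong (length ks +_) (length-concat-replicate n ks))

module Phases (l : ℕ) (1<l : 1 < l) where

  Primed : Config → Set
  Primed X = l ≤ P X 2

  data Phase : ℕ → Config → Set where
    partial : ∀ {j X} → 1 ≤ j → j < l → X 0 ≡ j → Primed X → Phase j X
    full    : ∀ {X} → l ≤ X 0 → Phase l X

  phase-≥1 : ∀ {j X} → Phase j X → 1 ≤ j
  phase-≥1 (partial 1≤j _ _ _) = 1≤j
  phase-≥1 (full _)            = <⇒≤ 1<l

  phase-≤ : ∀ {j X} → Phase j X → j ≤ l
  phase-≤ (partial _ j<l _ _) = <⇒≤ j<l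
  phase-≤ (full _)            = ≤-refl

  phase-≤-head : ∀ {j X} → Phase j X → j ≤ X 0
  phase-≤-head (partial _ _ X0≡j _) = ≤-reflexive (sym X0≡j)
  phase-≤-head (full l≤X0)          = l≤X0

  phase-primed : ∀ {j X} → Phase j X → Primed X
  phase-primed (partial _ _ _ primed)  = primed
  phase-primed {X = X} (full l≤X0)     = ≤-trans l≤X0 (m≤m+n (X 0) (X 1))

  primed-phase : ∀ {X} → Positive X → Primed X → Σ[ j ∈ ℕ ] Phase j X
  primed-phase {X} pos primed with X 0 <? l
  ... | yes X0<l = X 0 , partial (pos 0) X0<l refl primed
  ... | no  X0≮l = l , full (≮⇒≥ X0≮l)

  unprimed-head : ∀ {X} → ¬ Primed X → X 0 < l
  unprimed-head {X} unprimed = ≤-<-trans (m≤m+n (X 0) (X 1)) (≰⇒> unprimed)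

  primed-φ : ∀ {k X} → X 0 < k → k ≤ P X 2 → Primed X → Primed (φ k X)
  primed-φ {X = X} X0<k k≤P2 primed =
    subst₂ (λ a b → l ≤ a + b) (sym (φ-hits X 0 X0<k X0<k k≤P2)) (sym (φ-fixes-left X 1 X0<k k≤P2))
           (≤-trans primed (n≤1+n _))

  rotate-partial : ∀ {j X} → Phase j X → j < l → Phase (suc j) (φ l X)
  rotate-partial (full _) l<l = ⊥-elim (<-irrefl refl l<l)
  rotate-partial {j} {X} (partial _ j<l X0≡j primed) _ = grown (m≤n⇒m<n∨m≡n j<l)
    where
    X0<l : X 0 < l
    X0<l = subst (_< l) (sym X0≡j) j<l
    head : φ l X 0 ≡ suc j
    head = trans (φ-hits X 0 X0<l X0<l primed) (cong suc X0≡j)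
    grown : suc j < l ⊎ suc j ≡ l → Phase (suc j) (φ l X)
    grown (inj₁ 1+j<l) = partial (s≤s z≤n) 1+j<l head (primed-φ {X = X} X0<l primed primed)
    grown (inj₂ 1+j≡l) = subst (λ i → Phase i (φ l X)) (sym 1+j≡l)
                               (full (≤-reflexive (sym (trans head 1+j≡l))))

  rotate-full : ∀ {X} → Phase l X → Phase 1 (φ l X)
  rotate-full (partial _ l<l _ _) = ⊥-elim (<-irrefl refl l<l)
  rotate-full {X} (full l≤X0) = partial ≤-refl 1<l (φ-opens-head X l≤X0) primed
    where
    primed : Primed (φ l X)
    primed = subst₂ (λ a b → l ≤ a + b) (sym (φ-opens-head X l≤X0)) (sym (φ-shifts X 0 l≤X0))
                    (≤-trans l≤X0 (n≤1+n _))

  rotate-once : ∀ {j X} → Phase j X → Σ[ j′ ∈ ℕ ] Phase j′ (φ l X)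
  rotate-once ph with m≤n⇒m<n∨m≡n (phase-≤ ph)
  ... | inj₁ j<l  = _ , rotate-partial ph j<l
  ... | inj₂ refl = 1 , rotate-full ph

  rotate-many : ∀ {j X} → Phase j X → ∀ n → Σ[ j′ ∈ ℕ ] Phase j′ (iterate (φ l) X n)
  rotate-many ph zero    = _ , ph
  rotate-many ph (suc n) = rotate-many (proj₂ (rotate-once ph)) n

  rotate : ∀ n {j X} → Phase j X → j + n ≤ l → Phase (j + n) (iterate (φ l) X n)
  rotate zero    {j} {X} ph _     = subst (λ i → Phase i X) (sym (+-identityʳ j)) ph
  rotate (suc n) {j} {X} ph j+n≤l =
    subst (λ i → Phase i (iterate (φ l) (φ l X) n)) (sym (+-suc j n))
          (rotate n (rotate-partial ph j<l) (subst (_≤ l) (+-suc j n) j+n≤l))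
    where
    j<l : j < l
    j<l = <-≤-trans (m<m+n j (s≤s z≤n)) j+n≤l

  rotate-around : ∀ n p {j X} → Phase j X → j + n ≡ l + suc p → suc p ≤ l →
                  Phase (suc p) (iterate (φ l) X n)
  rotate-around n p {j} {X} ph j+n≡ p<l = subst (λ m → Phase (suc p) (iterate (φ l) X m)) n≡ around
    where
    n≡ : (l ∸ j) + suc p ≡ n
    n≡ = +-cancelˡ-≡ j _ _ (begin
      j + ((l ∸ j) + suc p) ≡⟨ sym (+-assoc j (l ∸ j) (suc p)) ⟩
      (j + (l ∸ j)) + suc p ≡⟨ cong (_+ suc p) (m+[n∸m]≡n (phase-≤ ph)) ⟩
      l + suc p             ≡⟨ sym j+n≡ ⟩
      j + n                 ∎)
      where open ≡-Reasoning
    to-full : Phase l (iterate (φ l) X (l ∸ j))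
    to-full = subst (λ i → Phase i (iterate (φ l) X (l ∸ j))) (m+[n∸m]≡n (phase-≤ ph))
                    (rotate (l ∸ j) ph (≤-reflexive (m+[n∸m]≡n (phase-≤ ph))))
    around : Phase (suc p) (iterate (φ l) X ((l ∸ j) + suc p))
    around = subst (Phase (suc p)) (sym (iterate-+ (φ l) X (l ∸ j) (suc p)))
                   (rotate p (rotate-full to-full) p<l)

  -- The result of φ_k on a phase ≥ k; φ_l then refills bin -1 until a phase is reached again.
  record Opened (c : ℕ) (Y : Config) : Set where
    constructor opened
    field
      head   : Y 0 ≡ 1
      second : Y 1 ≡ c
      beyond : l ≤ suc c + Y 2

  opened-step : ∀ {c Y} → Opened c Y → suc c < l → Opened (suc c) (φ l Y)
  opened-step {c} {Y} (opened Y0≡1 Y1≡c l≤) 1+c<l = opened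
    (trans (φ-fixes-right Y 0 Y0<l below) Y0≡1)
    (trans (φ-hits Y 1 Y0<l below third) (cong suc Y1≡c))
    (subst (λ y → l ≤ suc (suc c) + y) (sym (φ-fixes-left Y 2 Y0<l third)) (≤-trans l≤ (n≤1+n _)))
    where
    Y0<l : Y 0 < l
    Y0<l = subst (_< l) (sym Y0≡1) 1<l
    two : P Y 2 ≡ suc c
    two = cong₂ _+_ Y0≡1 Y1≡c
    below : P Y 2 < l
    below = subst (_< l) (sym two) 1+c<l
    third : l ≤ P Y 3
    third = subst (λ s → l ≤ s + Y 2) (sym two) l≤

  opened-close : ∀ {c Y} → Opened c Y → l ≤ suc c → Phase 1 Y
  opened-close {c} {Y} (opened Y0≡1 Y1≡c _) l≤1+c =
    partial ≤-refl 1<l Y0≡1 (subst₂ (λ a b → l ≤ a + b) (sym Y0≡1) (sym Y1≡c) l≤1+c)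

  opened-rotate : ∀ n {c Y} → Opened c Y → suc c + n ≡ l → Phase 1 (iterate (φ l) Y n)
  opened-rotate zero    {c} op 1+c≡l = opened-close op (≤-reflexive (trans (sym 1+c≡l) (+-identityʳ _)))
  opened-rotate (suc n) {c} op 1+c+n≡l =
    opened-rotate n (opened-step op 1+c<l) (trans (sym (+-suc (suc c) n)) 1+c+n≡l)
    where
    1+c<l : suc c < l
    1+c<l = subst (suc c <_) 1+c+n≡l (m<m+n (suc c) (s≤s z≤n))

  module _ {k : ℕ} (k<l : k < l) where

    φk-below : ∀ {j X} → Phase j X → j < k → Phase (suc j) (φ k X)
    φk-below (full _) l<k = ⊥-elim (<-asym l<k k<l)
    φk-below {j} {X} (partial _ _ X0≡j primed) j<k =
      partial (s≤s z≤n) (≤-<-trans j<k k<l) (trans (φ-hits X 0 X0<k X0<k k≤P2) (cong suc X0≡j))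
              (primed-φ {X = X} X0<k k≤P2 primed)
      where
      X0<k : X 0 < k
      X0<k = subst (_< k) (sym X0≡j) j<k
      k≤P2 : k ≤ P X 2
      k≤P2 = ≤-trans (<⇒≤ k<l) primed

    φk-above : ∀ {j X} → Phase j X → k ≤ j → Opened (X 0) (φ k X)
    φk-above {X = X} ph k≤j = opened (φ-opens-head X k≤X0) (φ-shifts X 0 k≤X0)
      (subst (λ y → l ≤ suc (X 0) + y) (sym (φ-shifts X 1 k≤X0)) (≤-trans (phase-primed ph) (n≤1+n _)))
      where
      k≤X0 : k ≤ X 0
      k≤X0 = ≤-trans k≤j (phase-≤-head ph)

    φk-above-return : ∀ {j X} → Phase j X → k ≤ j → Phase 1 (iterate (φ l) (φ k X) (l ∸ suc j))
    φk-above-return {X = X} ph@(partial _ j<l X0≡j _) k≤j =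
      opened-rotate _ (subst (λ c → Opened c (φ k X)) X0≡j (φk-above ph k≤j)) (m+[n∸m]≡n j<l)
    φk-above-return {X = X} ph@(full l≤X0) k≤j =
      subst (λ n → Phase 1 (iterate (φ l) (φ k X) n)) (sym (m≤n⇒m∸n≡0 (n≤1+n l)))
            (opened-close (φk-above ph k≤j) (≤-trans l≤X0 (n≤1+n _)))

  -- The potential that φ_l lowers as long as the configuration is unprimed.
  shortfall : Config → ℕ → ℕ
  shortfall X zero    = 0
  shortfall X (suc n) = shortfall X n + (l ∸ P X (suc n))

  shortfall-≤ : ∀ X n → shortfall X n ≤ n * l
  shortfall-≤ X zero    = z≤n
  shortfall-≤ X (suc n) =
    subst (shortfall X (suc n) ≤_) (+-comm (n * l) l) (+-mono-≤ (shortfall-≤ X n) (m∸n≤m l (P X (suc n))))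

  shortfall-antitone : ∀ {X Y} → (∀ i → P X i ≤ P Y i) → ∀ n → shortfall Y n ≤ shortfall X n
  shortfall-antitone P≤ zero    = z≤n
  shortfall-antitone P≤ (suc n) = +-mono-≤ (shortfall-antitone P≤ n) (∸-monoʳ-≤ l (P≤ (suc n)))

  shortfall-strict : ∀ {X Y i n} → (∀ i → P X i ≤ P Y i) → i < n → P X (suc i) < l →
                     P X (suc i) < P Y (suc i) → shortfall Y n < shortfall X n
  shortfall-strict {i = i} {suc n} P≤ i<1+n PX<l PX<PY with m≤n⇒m<n∨m≡n (≤-pred i<1+n)
  ... | inj₁ i<n  = +-mono-<-≤ (shortfall-strict P≤ i<n PX<l PX<PY) (∸-monoʳ-≤ l (P≤ (suc n)))
  ... | inj₂ refl = +-mono-≤-< (shortfall-antitone P≤ n)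
                               (≤-<-trans (∸-monoʳ-≤ l PX<PY) (∸-monoʳ-< (n<1+n _) PX<l))

  shortfall-unprimed : ∀ {X} → ¬ Primed X → ∀ {n} → 0 < n → 0 < shortfall X n
  shortfall-unprimed {X} unprimed {suc zero} _ = m<n⇒0<n∸m (unprimed-head {X} unprimed)
  shortfall-unprimed unprimed {suc (suc n)} _ =
    ≤-trans (shortfall-unprimed unprimed {suc n} (s≤s z≤n)) (m≤m+n _ _)

  shortfall-φ : ∀ {X} → Positive X → ¬ Primed X → shortfall (φ l X) l < shortfall X l
  shortfall-φ {X} pos unprimed =
    decrease (crossing (λ n → P X (suc n)) l 0 X0<l (≤-trans (m≤n⇒m≤1+n (m≤m+n l 0)) (P-≥-index pos _)))
    where
    X0<l : X 0 < l
    X0<l = unprimed-head {X} unprimed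
    grows : ∀ i → P X i ≤ P (φ l X) i
    grows = P-monoˡ-≤ (λ i → φ-inflationary X i X0<l)
    decrease : Σ[ m ∈ ℕ ] P X (suc m) < l × l ≤ P X (suc (suc m)) → shortfall (φ l X) l < shortfall X l
    decrease (m , below , above) = shortfall-strict grows m<l below strict
      where
      strict : P X (suc m) < P (φ l X) (suc m)
      strict = subst (_≤ P (φ l X) (suc m)) (+-suc (P X m) (X m))
                     (+-mono-≤ (grows m) (≤-reflexive (sym (φ-hits X m X0<l below above))))
      m<l : m < l
      m<l = <⇒≤ (≤-<-trans (P-≥-index pos (suc m)) below)

  reach-phase : ∀ n {X} → Positive X → shortfall X l ≤ n → Σ[ j ∈ ℕ ] Phase j (iterate (φ l) X n)
  reach-phase n       {X} pos bound with l ≤? P X 2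
  reach-phase n           pos bound | yes primed   = rotate-many (proj₂ (primed-phase pos primed)) n
  reach-phase zero        pos bound | no  unprimed =
    ⊥-elim (<⇒≱ (shortfall-unprimed unprimed (<-trans (s≤s z≤n) 1<l)) bound)
  reach-phase (suc n)     pos bound | no  unprimed =
    reach-phase n (φ-positive {l} pos) (≤-pred (≤-trans (shortfall-φ pos unprimed) bound))

  eventually-phase : ∀ {X} → Positive X → Σ[ j ∈ ℕ ] Phase j (iterate (φ l) X (l * l))
  eventually-phase {X} pos = reach-phase (l * l) pos (shortfall-≤ X l)

module Filling (l : ℕ) (1≤l : 1 ≤ l) where

  record Filled (shape : ℕ × ℕ) (W : Config) : Set where
    field
      head    : W 0 ≡ proj₂ shape
      head-≤  : proj₂ shape ≤ l
      body    : ∀ i → i < proj₁ shape → W (suc i) ≡ l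
      rest    : l ≤ W (suc (proj₁ shape))

  grow : ℕ × ℕ → ℕ × ℕ
  grow (a , b) with b <? l
  ... | yes _ = a , suc b
  ... | no  _ = suc a , 1

  count : ℕ × ℕ → ℕ
  count (a , b) = b + a * l

  grow-count : ∀ {a b} → b ≤ l → count (grow (a , b)) ≡ suc (count (a , b))
  grow-count {a} {b} b≤l with b <? l
  ... | yes _   = refl
  ... | no  b≮l = cong (λ c → suc (c + a * l)) (≤-antisym (≮⇒≥ b≮l) b≤l)

  filled-start : ∀ {Z} → l ≤ Z 0 → Filled (0 , 1) (φ l Z)
  filled-start {Z} l≤Z0 = record
    { head    = φ-opens-head Z l≤Z0
    ; head-≤  = 1≤l
    ; body    = λ _ ()
    ; rest    = subst (l ≤_) (sym (φ-shifts Z 0 l≤Z0)) l≤Z0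
    }

  filled-second : ∀ {a b W} → Filled (a , b) W → l ≤ W 1
  filled-second {zero}  f = Filled.rest f
  filled-second {suc a} f = ≤-reflexive (sym (Filled.body f 0 (s≤s z≤n)))

  filled-grow : ∀ {p W} → Filled p W → Filled (grow p) (φ l W)
  filled-grow {a , b} {W} f with b <? l
  ... | yes b<l = record
    { head    = trans (φ-hits W 0 W0<l W0<l second) (cong suc head)
    ; head-≤  = b<l
    ; body    = λ i i<a → trans (fixed i) (body i i<a)
    ; rest    = subst (l ≤_) (sym (fixed a)) rest
    }
    where
    open Filled f
    W0<l : W 0 < l
    W0<l = subst (_< l) (sym head) b<l
    second : l ≤ P W 2
    second = ≤-trans (filled-second f) (m≤n+m _ _)
    fixed : ∀ i → φ l W (suc i) ≡ W (suc i)
    fixed i = φ-fixes-left W (suc i) W0<l (≤-trans second (P-monoʳ-≤ W (s≤s (s≤s z≤n))))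
  ... | no b≮l = record
    { head    = φ-opens-head W l≤W0
    ; head-≤  = 1≤l
    ; body    = body′
    ; rest    = subst (l ≤_) (sym (φ-shifts W (suc a) l≤W0)) rest
    }
    where
    open Filled f
    W0≡l : W 0 ≡ l
    W0≡l = trans head (≤-antisym head-≤ (≮⇒≥ b≮l))
    l≤W0 : l ≤ W 0
    l≤W0 = ≤-reflexive (sym W0≡l)
    body′ : ∀ i → i < suc a → φ l W (suc i) ≡ l
    body′ zero    _         = trans (φ-shifts W 0 l≤W0) W0≡l
    body′ (suc i) (s≤s i<a) = trans (φ-shifts W (suc i) l≤W0) (body i i<a)

  filled-iterate : ∀ {p W} → Filled p W → ∀ t → Filled (iterate grow p t) (iterate (φ l) W t)
  filled-iterate f zero    = f
  filled-iterate f (suc t) = filled-iterate (filled-grow f) t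

  count-iterate : ∀ {p W} → Filled p W → ∀ t → count (iterate grow p t) ≡ count p + t
  count-iterate {p} f zero    = sym (+-identityʳ (count p))
  count-iterate {p} f (suc t) = begin
    count (iterate grow (grow p) t) ≡⟨ count-iterate (filled-grow f) t ⟩
    count (grow p) + t              ≡⟨ cong (_+ t) (grow-count (Filled.head-≤ f)) ⟩
    suc (count p) + t               ≡⟨ sym (+-suc (count p) t) ⟩
    count p + suc t                 ∎
    where open ≡-Reasoning

  filled-balls : ∀ {a b W} → Filled (a , b) W → ∀ i → i ≤ a → P W (suc i) ≡ b + i * l
  filled-balls {b = b} f zero    _   = trans (Filled.head f) (sym (+-identityʳ b))
  filled-balls {b = b} {W} f (suc i) i<a = begin
    P W (suc i) + W (suc i) ≡⟨ cong₂ _+_ (filled-balls f i (<⇒≤ i<a)) (Filled.body f i i<a) ⟩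
    (b + i * l) + l         ≡⟨ +-assoc b (i * l) l ⟩
    b + (i * l + l)         ≡⟨ cong (b +_) (+-comm (i * l) l) ⟩
    b + suc i * l           ∎
    where open ≡-Reasoning

  filled-couples : ∀ {p X Y} → Filled p X → Filled p Y → ∀ m → π (count p) X m ≡ π (count p) Y m
  filled-couples {a , b} {X} {Y} fX fY = π-cong-prefix agree (≤-reflexive (sym (filled-balls fX a ≤-refl)))
    where
    agree : ∀ i → i ≤ a → X i ≡ Y i
    agree zero    _     = trans (Filled.head fX) (sym (Filled.head fY))
    agree (suc i) 1+i≤a = trans (Filled.body fX i 1+i≤a) (sym (Filled.body fY i 1+i≤a))

  fill-couples : ∀ {X Y} → l ≤ X 0 → l ≤ Y 0 → ∀ t m →
                 π (suc t) (iterate (φ l) X (suc t)) m ≡ π (suc t) (iterate (φ l) Y (suc t)) m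
  fill-couples {X} {Y} l≤X0 l≤Y0 t =
    subst (λ N → ∀ m → π N (iterate (φ l) (φ l X) t) m ≡ π N (iterate (φ l) (φ l Y) t) m)
          (count-iterate fX t)
          (filled-couples (filled-iterate fX t) (filled-iterate (filled-start l≤Y0) t))
    where
    fX = filled-start l≤X0

module Synchronise (K L : ℕ) (K≤L : K ≤ L) where

  k l : ℕ
  k = suc K
  l = suc (suc L)

  k<l : k < l
  k<l = s≤s (s≤s K≤L)

  open Phases l (s≤s (s≤s z≤n))

  block : ℕ → List ℕ
  block s = replicate s l ++ [ k ]

  run-block : ∀ s X → run (block s) X ≡ iterate (φ l) (φ k X) s
  run-block s X = trans (run-++ (replicate s l) [ k ] X) (run-replicate s l (φ k X))

  block-below : ∀ s {j X} → Phase j X → j < k → suc j + s ≤ l → Phase (suc j + s) (run (block s) X)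
  block-below s {X = X} ph j<k bound =
    subst (Phase _) (sym (run-block s X)) (rotate s (φk-below k<l ph j<k) bound)

  block-below-around : ∀ s p {j X} → Phase j X → j < k → suc j + s ≡ l + suc p → suc p ≤ l →
                       Phase (suc p) (run (block s) X)
  block-below-around s p {X = X} ph j<k around p<l =
    subst (Phase _) (sym (run-block s X)) (rotate-around s p (φk-below k<l ph j<k) around p<l)

  block-above : ∀ s r {j X} → Phase j X → k ≤ j → (l ∸ suc j) + r ≡ s → suc r ≤ l →
                Phase (suc r) (run (block s) X)
  block-above s r {j} {X} ph k≤j s≡ r<l =
    subst (Phase (suc r)) (trans (sym (iterate-+ (φ l) (φ k X) (l ∸ suc j) r))
                                 (trans (cong (iterate (φ l) (φ k X)) s≡) (sym (run-block s X))))
          (rotate r (φk-above-return k<l ph k≤j) r<l)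

  -- On phases, block L lowers j < k by one (1 ↦ l), fixes k ≤ j < l and sends l to l - 1,
  -- while block (suc L) fixes j < k, raises k ≤ j < l by one and fixes l.

  block₁-above : ∀ {j X} → Phase j X → k ≤ j → Σ[ j′ ∈ ℕ ] Phase j′ (run (block L) X) × k ≤ j′
  block₁-above {j} ph k≤j with suc j <? l
  block₁-above {suc i} ph k≤j | yes (s≤s (s≤s i<L)) =
    suc i , block-above L i ph k≤j (m∸n+n≡m (<⇒≤ i<L)) (m≤n⇒m≤1+n (m≤n⇒m≤1+n i<L)) , k≤j
  block₁-above {j}     ph k≤j | no  1+j≮l =
    suc L , block-above L L ph k≤j (cong (_+ L) (m≤n⇒m∸n≡0 (≮⇒≥ 1+j≮l))) (n≤1+n _) , s≤s K≤L

  block₁-below : ∀ {j X} → Phase j X → j < k →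
                 Σ[ j′ ∈ ℕ ] Phase j′ (run (block L) X) × (k ≤ j′ ⊎ suc j′ ≡ j)
  block₁-below {zero}        ph j<k = ⊥-elim (<-irrefl refl (phase-≥1 ph))
  block₁-below {suc zero}    ph j<k = l , block-below L ph j<k ≤-refl , inj₁ (<⇒≤ k<l)
  block₁-below {suc (suc i)} ph j<k =
    suc i , block-below-around L i ph j<k around (<⇒≤ (phase-≤ ph)) , inj₂ refl
    where
    around : suc (suc (suc i)) + L ≡ l + suc i
    around = cong (suc ∘ suc) (sym (trans (+-suc L i) (cong suc (+-comm L i))))

  block₂ : ∀ {j X} → Phase j X → k ≤ j →
           Σ[ j′ ∈ ℕ ] Phase j′ (run (block (suc L)) X) × (j < j′ ⊎ j′ ≡ l)
  block₂ {j} ph k≤j with suc j <? l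
  block₂ {suc i} ph k≤j | yes (s≤s (s≤s i<L)) =
    suc (suc i) , block-above (suc L) (suc i) ph k≤j s≡ (s≤s (s≤s (<⇒≤ i<L))) , inj₁ ≤-refl
    where
    s≡ : (L ∸ i) + suc i ≡ suc L
    s≡ = trans (+-suc (L ∸ i) i) (cong suc (m∸n+n≡m (<⇒≤ i<L)))
  block₂ {j}     ph k≤j | no  1+j≮l =
    l , block-above (suc L) (suc L) ph k≤j (cong (_+ suc L) (m≤n⇒m∸n≡0 (≮⇒≥ 1+j≮l))) ≤-refl ,
    inj₂ refl

  stage₁ : ∀ n {j X} → Phase j X → (j < k → j ≤ n) →
           Σ[ j′ ∈ ℕ ] Phase j′ (iterate (run (block L)) X n) × k ≤ j′
  stage₁ n {j} ph pending with k ≤? j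
  stage₁ zero    ph pending | yes k≤j = _ , ph , k≤j
  stage₁ (suc n) ph pending | yes k≤j with block₁-above ph k≤j
  ... | _ , ph′ , k≤j′ = stage₁ n ph′ (λ j′<k → ⊥-elim (<⇒≱ j′<k k≤j′))
  stage₁ zero    ph pending | no  k≰j = ⊥-elim (<⇒≱ (phase-≥1 ph) (pending (≰⇒> k≰j)))
  stage₁ (suc n) ph pending | no  k≰j with block₁-below ph (≰⇒> k≰j)
  ... | _ , ph′ , inj₁ k≤j′ = stage₁ n ph′ (λ j′<k → ⊥-elim (<⇒≱ j′<k k≤j′))
  ... | _ , ph′ , inj₂ refl = stage₁ n ph′ (λ _ → ≤-pred (pending (≰⇒> k≰j)))

  stage₂ : ∀ n {j X} → Phase j X → k ≤ j → l ≤ j + n → Phase l (iterate (run (block (suc L))) X n)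
  stage₂ zero    {j} {X} ph _ l≤j =
    subst (λ i → Phase i X) (≤-antisym (phase-≤ ph) (subst (l ≤_) (+-identityʳ j) l≤j)) ph
  stage₂ (suc n) {j} ph k≤j l≤j+n with block₂ ph k≤j
  ... | j′ , ph′ , inj₁ j<j′ = stage₂ n ph′ (≤-trans k≤j (<⇒≤ j<j′)) (≤-trans l≤j+n j+1+n≤j′+n)
    where
    j+1+n≤j′+n : j + suc n ≤ j′ + n
    j+1+n≤j′+n = subst (_≤ j′ + n) (sym (+-suc j n)) (+-monoˡ-≤ n j<j′)
  ... | _  , ph′ , inj₂ refl = stage₂ n ph′ (<⇒≤ k<l) (m≤m+n l n)

  priming lowering raising synchroniser : List ℕ
  priming      = replicate (l * l) l
  lowering     = concat (replicate K (block L))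
  raising      = concat (replicate (l ∸ k) (block (suc L)))
  synchroniser = raising ++ lowering ++ priming

  run-synchroniser : ∀ X → run synchroniser X ≡
    iterate (run (block (suc L))) (iterate (run (block L)) (iterate (φ l) X (l * l)) K) (l ∸ k)
  run-synchroniser X = begin
    run synchroniser X                                         ≡⟨ run-++ raising _ X ⟩
    run raising (run (lowering ++ priming) X)                  ≡⟨ cong (run raising) (run-++ lowering priming X) ⟩
    run raising (run lowering (run priming X))                 ≡⟨ cong (run raising ∘ run lowering)
                                                                       (run-replicate (l * l) l X) ⟩
    run raising (run lowering (iterate (φ l) X (l * l)))       ≡⟨ cong (run raising)
                                                                       (run-concat-replicate K (block L) _) ⟩
    run raising (iterate (run (block L)) (iterate (φ l) X (l * l)) K) ≡⟨ run-concat-replicate (l ∸ k) (block (suc L)) _ ⟩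
    iterate (run (block (suc L))) (iterate (run (block L)) (iterate (φ l) X (l * l)) K) (l ∸ k) ∎
    where open ≡-Reasoning

  synchronise : ∀ {X} → Positive X → l ≤ run synchroniser X 0
  synchronise {X} pos with eventually-phase pos
  ... | _ , ph₀ with stage₁ K ph₀ ≤-pred
  ...   | j₁ , ph₁ , k≤j₁ =
    subst (λ Z → l ≤ Z 0) (sym (run-synchroniser X)) (phase-≤-head (stage₂ (l ∸ k) ph₁ k≤j₁ l≤))
    where
    l≤ : l ≤ j₁ + (l ∸ k)
    l≤ = ≤-trans (≤-reflexive (sym (m+[n∸m]≡n (<⇒≤ k<l)))) (+-monoˡ-≤ (l ∸ k) k≤j₁)

  algorithm : ℕ → List ℕ
  algorithm N = replicate (suc N) l ++ synchroniser

  couples : ∀ N → Couples (suc N) (algorithm N)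
  couples N X Y posX posY m = begin
    π (suc N) (run (algorithm N) X) m                         ≡⟨ cong (λ Z → π (suc N) Z m) (run-algorithm X) ⟩
    π (suc N) (iterate (φ l) (run synchroniser X) (suc N)) m  ≡⟨ fill-couples {run synchroniser X} {run synchroniser Y}
                                                                     (synchronise posX) (synchronise posY) N m ⟩
    π (suc N) (iterate (φ l) (run synchroniser Y) (suc N)) m  ≡⟨ cong (λ Z → π (suc N) Z m) (sym (run-algorithm Y)) ⟩
    π (suc N) (run (algorithm N) Y) m                         ∎
    where
    open ≡-Reasoning
    open Filling l (s≤s z≤n) using (fill-couples)
    run-algorithm : ∀ Z → run (algorithm N) Z ≡ iterate (φ l) (run synchroniser Z) (suc N)
    run-algorithm Z = trans (run-++ (replicate (suc N) l) synchroniser Z) (run-replicate (suc N) l (run synchroniser Z))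

  Move : ℕ → Set
  Move j = j ≡ k ⊎ j ≡ l

  algorithm-moves : ∀ N → All Move (algorithm N)
  algorithm-moves N = ++⁺ (φls (suc N)) (++⁺ (blocks (l ∸ k) (suc L)) (++⁺ (blocks K L) (φls (l * l))))
    where
    φls : ∀ n → All Move (replicate n l)
    φls n = replicate⁺ n (inj₂ refl)
    blocks : ∀ n s → All Move (concat (replicate n (block s)))
    blocks n s = concat⁺ (replicate⁺ n (++⁺ (φls s) (inj₁ refl ∷ [])))

  length-block : ∀ s → length (block s) ≡ s + 1
  length-block s = trans (length-++ (replicate s l)) (cong (_+ 1) (length-replicate s))

  length-blocks : ∀ n s → length (concat (replicate n (block s))) ≡ n * (s + 1)
  length-blocks n s = trans (length-concat-replicate n (block s)) (cong (n *_) (length-block s))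

  length-synchroniser : length synchroniser ≤ 3 * (l * l)
  length-synchroniser = begin
    length synchroniser                               ≡⟨ length-++ raising ⟩
    length raising + length (lowering ++ priming)     ≡⟨ cong (length raising +_) (length-++ lowering) ⟩
    length raising + (length lowering + length priming)
      ≡⟨ cong₂ _+_ (length-blocks (l ∸ k) (suc L)) (cong₂ _+_ (length-blocks K L) (length-replicate (l * l))) ⟩
    (l ∸ k) * (suc L + 1) + (K * (L + 1) + l * l)     ≤⟨ +-mono-≤ raising-≤ (+-mono-≤ lowering-≤ ≤-refl) ⟩
    l * l + (l * l + l * l)                           ≡⟨ cong (λ x → l * l + (l * l + x)) (sym (+-identityʳ (l * l))) ⟩
    3 * (l * l)                                       ∎
    where
    open ≤-Reasoning
    raising-≤ : (l ∸ k) * (suc L + 1) ≤ l * l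
    raising-≤ = *-mono-≤ (m∸n≤m l k) (≤-reflexive (+-comm (suc L) 1))
    lowering-≤ : K * (L + 1) ≤ l * l
    lowering-≤ = *-mono-≤ (≤-trans K≤L (m≤n⇒m≤1+n (n≤1+n L))) (≤-trans (≤-reflexive (+-comm L 1)) (n≤1+n _))

  length-algorithm : ∀ N → length (algorithm N) < suc N + 4 * l ^ 2
  length-algorithm N = begin-strict
    length (algorithm N)                                ≡⟨ length-++ (replicate (suc N) l) ⟩
    length (replicate (suc N) l) + length synchroniser  ≡⟨ cong (_+ length synchroniser) (length-replicate (suc N)) ⟩
    suc N + length synchroniser                         ≤⟨ +-monoʳ-≤ (suc N) length-synchroniser ⟩
    suc N + 3 * (l * l)                                 <⟨ +-monoʳ-< (suc N) (*-monoˡ-< (l * l) (n<1+n 3)) ⟩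
    suc N + 4 * (l * l)                                 ≡⟨ cong (λ x → suc N + 4 * (l * x)) (sym (*-identityʳ l)) ⟩
    suc N + 4 * l ^ 2                                   ∎
    where open ≤-Reasoning

theorem1 : (N k l : ℕ) → 1 ≤ N → 1 ≤ k → k < l →
    Σ (List ℕ) (λ ks →
      All (λ j → j ≡ k ⊎ j ≡ l) ks
      × Couples N ks
      × length ks < N + 4 * l ^ 2)
theorem1 zero    _       _             ()  _  _
theorem1 (suc N) zero    _             _   () _
theorem1 (suc N) (suc K) zero          _   _  ()
theorem1 (suc N) (suc K) (suc zero)    _   _  (s≤s ())
theorem1 (suc N) (suc K) (suc (suc L)) _   _  (s≤s (s≤s K≤L)) =
  algorithm N , algorithm-moves N , couples N , length-algorithm N
  where open Synchronise K L K≤L
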